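{- The Tribonacci sequence is $3$-pseudoperiodic, but not $2$-pseudoperiodic.
   Context: The Tribonacci sequence is the infinite fixed point, starting with $0$, of the morphism $0\mapsto01$, $1\mapsto02$, $2\mapsto0$; it is indexed from $0$. For integers $k\ge1$ and $0<p_1<\cdots<p_k$, an infinite word $\mathbf{s}$ has pseudoperiod $(p_1,\ldots,p_k)$ if $\mathbf{s}[i]\in\{\mathbf{s}[i+p_1],\ldots,\mathbf{s}[i+p_k]\}$ for all $i\ge0$; it is $k$-pseudoperiodic if it has some pseudoperiod with exactly $k$ entries. -}

module Defs where

open import Data.Nat using (ℕ; zero; suc; _+_; _<_)
open import Data.Fin using (Fin; zero; suc)
open import Data.List using (List; []; _∷_; _++_; concatMap)
open import Data.Vec using (Vec; lookup)
open import Data.Product using (Σ; _×_; ∃)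
open import Relation.Binary.PropositionalEquality using (_≡_)

Letter : Set
Letter = Fin 3

φ : Letter → List Letter
φ zero             = zero ∷ suc zero ∷ []
φ (suc zero)       = zero ∷ suc (suc zero) ∷ []
φ (suc (suc zero)) = zero ∷ []

φ* : List Letter → List Letter
φ* = concatMap φ

φ^ : ℕ → List Letter
φ^ zero    = zero ∷ []
φ^ (suc n) = φ* (φ^ n)

nth : List Letter → ℕ → Letter
nth []       _       = zero
nth (x ∷ xs) zero    = x
nth (x ∷ xs) (suc i) = nth xs (i)

-- The Tribonacci sequence t = lim φ^n(0), indexed from 0.
-- Each φ^n(0) is a prefix of φ^(n+1)(0), and |φ^(i+1)(0)| ≥ i+2,
-- so position i of the fixed point is position i of φ^(i+1)(0)
-- (the default in nth is never used).
tribonacci : ℕ → Letter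
tribonacci i = nth (φ^ (suc i)) i

StrictlyIncreasingPos : ∀ {k} → Vec ℕ k → Set
StrictlyIncreasingPos {k} p =
  (∀ (j : Fin k) → 0 < lookup p j) ×
  (∀ (j j′ : Fin k) → Data.Fin._<_ j j′ → lookup p j < lookup p j′)

HasPseudoperiod : (ℕ → Letter) → ∀ {k} → Vec ℕ k → Set
HasPseudoperiod s {k} p =
  StrictlyIncreasingPos p ×
  (∀ (i : ℕ) → Σ (Fin k) λ j → s i ≡ s (i + lookup p j))

Pseudoperiodic : ℕ → (ℕ → Letter) → Set
Pseudoperiodic k s = Σ (Vec ℕ k) λ p → HasPseudoperiod s p

{-# OPTIONS --safe #-}
module Submission where

-- The pseudoperiod (4,6,7) is a finite check: the length-8 windows of the words φ^n(0)
-- range over an explicit set of words closed under φ, and every word w of length 8 in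
-- it has w[0] ∈ {w[4], w[6], w[7]}.  No pair (p,q) works: since
-- φ^(n+3)(0) = φ^(n+2)(0) φ^(n+1)(0) φ^n(0), the last letter of φ^(n+3)(0) is that of
-- φ^n(0), so it cycles through 0, 1, 2, and in t it is followed by the prefix
-- φ^(n+2)(0) of t.  Choosing n large with that letter different from t[p-1] and
-- t[q-1] gives a position i with t[i] ∉ {t[i+p], t[i+q]}.

open import Defs
open import Data.Product using (_×_; Σ; _,_; proj₁; proj₂)
open import Function using (_∘_)
open import Data.Nat
  using (ℕ; zero; suc; _+_; _*_; _≤_; _<_; z≤n; s≤s; _≤?_; _<?_)
open import Data.Nat.Properties
  using ( +-comm; +-identityʳ; +-monoʳ-<; ≤-trans; ≤-reflexive; <-trans; <-≤-trans; <⇒≤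
        ; ≰⇒>; n<1+n; n≮0; m≤m+n; m≤n+m; m<m+n; m≤m*n; m≤n⇒m≤1+n; m≤n⇒m⊓n≡m
        ; m+n≤o⇒m≤o∸n; module ≤-Reasoning )
open import Data.Fin using (Fin; zero; suc; toℕ)
open import Data.Fin.Properties using (all?; any?)
open import Data.List using (List; []; _∷_; _++_; length; take; drop)
open import Data.List.Properties
  using (++-assoc; ++-identityʳ; length-++; length-++-≤ˡ; length-take; length-drop
        ; take-all; take++drop≡id; ≡-dec)
open import Data.List.Membership.Propositional using (_∈_)
open import Data.List.Membership.DecPropositional (≡-dec (Data.Fin._≟_ {3})) using (_∈?_)
open import Data.List.Relation.Unary.All as All using (All)
open import Data.List.Relation.Unary.Any using (here; there)
open import Data.Vec using (Vec; []; _∷_; lookup)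
open import Data.Unit using (tt)
open import Relation.Nullary using (¬_; Dec; yes; no; _×-dec_; _→-dec_)
open import Relation.Nullary.Decidable using (toWitness)
open import Relation.Binary.PropositionalEquality
  using (_≡_; _≢_; refl; sym; trans; cong; subst; module ≡-Reasoning)

pattern l₀ = zero
pattern l₁ = suc zero
pattern l₂ = suc (suc zero)

nth-++ˡ : ∀ xs ys {j} → j < length xs → nth (xs ++ ys) j ≡ nth xs j
nth-++ˡ (x ∷ xs) ys {zero}  _         = refl
nth-++ˡ (x ∷ xs) ys {suc j} (s≤s j<n) = nth-++ˡ xs ys j<n

nth-++ʳ : ∀ xs ys j → nth (xs ++ ys) (length xs + j) ≡ nth ys j
nth-++ʳ []       ys j = refl
nth-++ʳ (x ∷ xs) ys j = nth-++ʳ xs ys j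

nth-drop : ∀ i xs j → nth (drop i xs) j ≡ nth xs (i + j)
nth-drop zero    xs       j       = refl
nth-drop (suc i) []       zero    = refl
nth-drop (suc i) []       (suc j) = refl
nth-drop (suc i) (x ∷ xs) j       = nth-drop i xs j

nth-take : ∀ m xs {j} → j < m → nth (take m xs) j ≡ nth xs j
nth-take (suc m) []       _         = refl
nth-take (suc m) (x ∷ xs) {zero}  _         = refl
nth-take (suc m) (x ∷ xs) {suc j} (s≤s j<m) = nth-take m xs j<m

take-++ˡ : ∀ {A : Set} m (xs ys : List A) → m ≤ length xs → take m (xs ++ ys) ≡ take m xs
take-++ˡ zero    xs       ys _         = refl
take-++ˡ (suc m) (x ∷ xs) ys (s≤s m≤n) = cong (x ∷_) (take-++ˡ m xs ys m≤n)

φ*-++ : ∀ xs ys → φ* (xs ++ ys) ≡ φ* xs ++ φ* ys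
φ*-++ []       ys = refl
φ*-++ (x ∷ xs) ys = begin
  φ x ++ φ* (xs ++ ys)      ≡⟨ cong (φ x ++_) (φ*-++ xs ys) ⟩
  φ x ++ (φ* xs ++ φ* ys)   ≡⟨ sym (++-assoc (φ x) (φ* xs) (φ* ys)) ⟩
  (φ x ++ φ* xs) ++ φ* ys   ∎
  where open ≡-Reasoning

length-φ* : ∀ xs → length xs ≤ length (φ* xs)
length-φ* []        = z≤n
length-φ* (l₀ ∷ xs) = s≤s (m≤n⇒m≤1+n (length-φ* xs))
length-φ* (l₁ ∷ xs) = s≤s (m≤n⇒m≤1+n (length-φ* xs))
length-φ* (l₂ ∷ xs) = s≤s (length-φ* xs)

take-φ* : ∀ m xs → take m (φ* xs) ≡ take m (φ* (take m xs))
take-φ* m xs with m ≤? length xs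
... | no m≰n = cong (take m ∘ φ*) (sym (take-all m xs (<⇒≤ (≰⇒> m≰n))))
... | yes m≤n = begin
  take m (φ* xs)                                ≡⟨ cong (take m ∘ φ*) (sym (take++drop≡id m xs)) ⟩
  take m (φ* (take m xs ++ drop m xs))          ≡⟨ cong (take m) (φ*-++ (take m xs) (drop m xs)) ⟩
  take m (φ* (take m xs) ++ φ* (drop m xs))     ≡⟨ take-++ˡ m _ _ m≤φ*-take ⟩
  take m (φ* (take m xs))                       ∎
  where
  open ≡-Reasoning
  m≤φ*-take : m ≤ length (φ* (take m xs))
  m≤φ*-take = ≤-trans (≤-reflexive (sym (trans (length-take m xs) (m≤n⇒m⊓n≡m m≤n))))
                      (length-φ* (take m xs))

φ^-suc-extends : ∀ n → Σ (List Letter) λ s → 0 < length s × φ^ (suc n) ≡ φ^ n ++ s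
φ^-suc-extends zero = l₁ ∷ [] , s≤s z≤n , refl
φ^-suc-extends (suc n) with φ^-suc-extends n
... | s , 0<s , eq = φ* s , <-≤-trans 0<s (length-φ* s) , (begin
  φ* (φ^ (suc n))          ≡⟨ cong φ* eq ⟩
  φ* (φ^ n ++ s)           ≡⟨ φ*-++ (φ^ n) s ⟩
  φ^ (suc n) ++ φ* s       ∎)
  where open ≡-Reasoning

n<length-φ^ : ∀ n → n < length (φ^ n)
n<length-φ^ zero = s≤s z≤n
n<length-φ^ (suc n) with φ^-suc-extends n
... | s , 0<s , eq = begin-strict
  suc n                        ≤⟨ n<length-φ^ n ⟩
  length (φ^ n)                <⟨ m<m+n (length (φ^ n)) 0<s ⟩
  length (φ^ n) + length s     ≡⟨ sym (length-++ (φ^ n)) ⟩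
  length (φ^ n ++ s)           ≡⟨ cong length (sym eq) ⟩
  length (φ^ (suc n))          ∎
  where open ≤-Reasoning

φ^-prefix : ∀ d n → Σ (List Letter) λ s → φ^ (d + n) ≡ φ^ n ++ s
φ^-prefix zero n = [] , sym (++-identityʳ (φ^ n))
φ^-prefix (suc d) n with φ^-prefix d n | φ^-suc-extends (d + n)
... | s , eq | s′ , _ , eq′ = s ++ s′ , (begin
  φ^ (suc d + n)           ≡⟨ eq′ ⟩
  φ^ (d + n) ++ s′         ≡⟨ cong (_++ s′) eq ⟩
  (φ^ n ++ s) ++ s′        ≡⟨ ++-assoc (φ^ n) s s′ ⟩
  φ^ n ++ s ++ s′          ∎)
  where open ≡-Reasoning

nth-φ^-stable : ∀ d n {j} → j < length (φ^ n) → nth (φ^ (d + n)) j ≡ nth (φ^ n) j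
nth-φ^-stable d n {j} j<n with φ^-prefix d n
... | s , eq = trans (cong (λ w → nth w j) eq) (nth-++ˡ (φ^ n) s j<n)

tribonacci-φ^ : ∀ N {j} → j < length (φ^ N) → tribonacci j ≡ nth (φ^ N) j
tribonacci-φ^ N {j} j<N = begin
  nth (φ^ (suc j)) j        ≡⟨ sym (nth-φ^-stable N (suc j) j<1+j) ⟩
  nth (φ^ (N + suc j)) j    ≡⟨ cong (λ k → nth (φ^ k) j) (+-comm N (suc j)) ⟩
  nth (φ^ (suc j + N)) j    ≡⟨ nth-φ^-stable (suc j) N j<N ⟩
  nth (φ^ N) j              ∎
  where
  open ≡-Reasoning
  j<1+j : j < length (φ^ (suc j))
  j<1+j = <-trans (n<1+n j) (n<length-φ^ (suc j))

tribonacci-infix : ∀ N P ys {j} → φ^ N ≡ P ++ ys → j < length ys →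
                   tribonacci (length P + j) ≡ nth ys j
tribonacci-infix N P ys {j} eq j<ys = begin
  tribonacci (length P + j)        ≡⟨ tribonacci-φ^ N bound ⟩
  nth (φ^ N) (length P + j)        ≡⟨ cong (λ w → nth w (length P + j)) eq ⟩
  nth (P ++ ys) (length P + j)     ≡⟨ nth-++ʳ P ys j ⟩
  nth ys j                         ∎
  where
  open ≡-Reasoning
  bound : length P + j < length (φ^ N)
  bound = subst (length P + j <_) (trans (sym (length-++ P)) (cong length (sym eq)))
                (+-monoʳ-< (length P) j<ys)

φ^-three-blocks : ∀ n → φ^ (3 + n) ≡ φ^ (2 + n) ++ φ^ (1 + n) ++ φ^ n
φ^-three-blocks zero    = refl
φ^-three-blocks (suc n) = begin
  φ* (φ^ (3 + n))                              ≡⟨ cong φ* (φ^-three-blocks n) ⟩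
  φ* (φ^ (2 + n) ++ φ^ (1 + n) ++ φ^ n)        ≡⟨ φ*-++ (φ^ (2 + n)) _ ⟩
  φ^ (3 + n) ++ φ* (φ^ (1 + n) ++ φ^ n)        ≡⟨ cong (φ^ (3 + n) ++_) (φ*-++ (φ^ (1 + n)) (φ^ n)) ⟩
  φ^ (3 + n) ++ φ^ (2 + n) ++ φ^ (1 + n)       ∎
  where open ≡-Reasoning

lastLetter : ℕ → Letter
lastLetter 0                   = l₀
lastLetter 1                   = l₁
lastLetter 2                   = l₂
lastLetter (suc (suc (suc n))) = lastLetter n

φ^-ends-with-lastLetter : ∀ n → Σ (List Letter) λ P → φ^ n ≡ P ++ lastLetter n ∷ []
φ^-ends-with-lastLetter 0 = [] , refl
φ^-ends-with-lastLetter 1 = l₀ ∷ [] , refl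
φ^-ends-with-lastLetter 2 = l₀ ∷ l₁ ∷ l₀ ∷ [] , refl
φ^-ends-with-lastLetter (suc (suc (suc n))) with φ^-ends-with-lastLetter n
... | P , eq = φ^ (2 + n) ++ φ^ (1 + n) ++ P , (begin
  φ^ (3 + n)                          ≡⟨ φ^-three-blocks n ⟩
  A ++ B ++ φ^ n                      ≡⟨ cong (λ w → A ++ B ++ w) eq ⟩
  A ++ B ++ (P ++ c ∷ [])             ≡⟨ cong (A ++_) (sym (++-assoc B P (c ∷ []))) ⟩
  A ++ (B ++ P) ++ c ∷ []             ≡⟨ sym (++-assoc A (B ++ P) (c ∷ [])) ⟩
  (A ++ B ++ P) ++ c ∷ []             ∎)
  where
  open ≡-Reasoning
  A B : List Letter
  A = φ^ (2 + n)
  B = φ^ (1 + n)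
  c : Letter
  c = lastLetter n

lastLetter-*3+ : ∀ q r → lastLetter (q * 3 + r) ≡ lastLetter r
lastLetter-*3+ zero    r = refl
lastLetter-*3+ (suc q) r = lastLetter-*3+ q r

lastLetter-toℕ : ∀ c → lastLetter (toℕ c) ≡ c
lastLetter-toℕ l₀ = refl
lastLetter-toℕ l₁ = refl
lastLetter-toℕ l₂ = refl

lastLetter-surjective-beyond : ∀ c m → Σ ℕ λ n → m ≤ n × lastLetter n ≡ c
lastLetter-surjective-beyond c m =
  m * 3 + toℕ c ,
  ≤-trans (m≤m*n m 3) (m≤m+n (m * 3) (toℕ c)) ,
  trans (lastLetter-*3+ m (toℕ c)) (lastLetter-toℕ c)

tribonacci-letter-before-prefix : ∀ c m → Σ ℕ λ i →
  tribonacci i ≡ c × (∀ a → a < m → tribonacci (i + suc a) ≡ tribonacci a)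
tribonacci-letter-before-prefix c m with lastLetter-surjective-beyond c m
... | n , m≤n , refl with φ^-ends-with-lastLetter (3 + n)
... | P , eq = length P , letter , prefix
  where
  open ≡-Reasoning
  A R : List Letter
  A = φ^ (2 + n)
  R = A ++ φ^ (1 + n)
  split : φ^ (4 + n) ≡ P ++ lastLetter n ∷ R
  split = begin
    φ^ (4 + n)                       ≡⟨ φ^-three-blocks (1 + n) ⟩
    φ^ (3 + n) ++ R                  ≡⟨ cong (_++ R) eq ⟩
    (P ++ lastLetter n ∷ []) ++ R    ≡⟨ ++-assoc P (lastLetter n ∷ []) R ⟩
    P ++ lastLetter n ∷ R            ∎
  letter : tribonacci (length P) ≡ lastLetter n
  letter = trans (cong tribonacci (sym (+-identityʳ (length P))))
                 (tribonacci-infix (4 + n) P _ split (s≤s z≤n))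
  prefix : ∀ a → a < m → tribonacci (length P + suc a) ≡ tribonacci a
  prefix a a<m = begin
    tribonacci (length P + suc a)    ≡⟨ tribonacci-infix (4 + n) P _ split (s≤s a<R) ⟩
    nth R a                          ≡⟨ nth-++ˡ A (φ^ (1 + n)) a<A ⟩
    nth A a                          ≡⟨ sym (tribonacci-φ^ (2 + n) a<A) ⟩
    tribonacci a                     ∎
    where
    a<A : a < length A
    a<A = <-trans (<-≤-trans a<m (≤-trans m≤n (m≤n+m n 2))) (n<length-φ^ (2 + n))
    a<R : a < length R
    a<R = <-≤-trans a<A (length-++-≤ˡ A)

avoid : (x y : Letter) → Σ Letter λ c → c ≢ x × c ≢ y
avoid l₀ l₀ = l₁ , (λ ()) , (λ ())
avoid l₀ l₁ = l₂ , (λ ()) , (λ ())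
avoid l₀ l₂ = l₁ , (λ ()) , (λ ())
avoid l₁ l₀ = l₂ , (λ ()) , (λ ())
avoid l₁ l₁ = l₀ , (λ ()) , (λ ())
avoid l₁ l₂ = l₀ , (λ ()) , (λ ())
avoid l₂ l₀ = l₁ , (λ ()) , (λ ())
avoid l₂ l₁ = l₀ , (λ ()) , (λ ())
avoid l₂ l₂ = l₀ , (λ ()) , (λ ())

¬2-pseudoperiodic : (s : ℕ → Letter) →
  (∀ c m → Σ ℕ λ i → s i ≡ c × (∀ a → a < m → s (i + suc a) ≡ s a)) →
  ¬ Pseudoperiodic 2 s
¬2-pseudoperiodic s occurs (zero ∷ _ ∷ [] , (positive , _) , _) = n≮0 (positive zero)
¬2-pseudoperiodic s occurs (_ ∷ zero ∷ [] , (positive , _) , _) = n≮0 (positive (suc zero))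
¬2-pseudoperiodic s occurs (suc a ∷ suc b ∷ [] , _ , covered) with avoid (s a) (s b)
... | c , c≢sa , c≢sb with occurs c (suc (a + b))
... | i , si≡c , followed with covered i
... | zero , eq = c≢sa (begin
  c                 ≡⟨ sym si≡c ⟩
  s i               ≡⟨ eq ⟩
  s (i + suc a)     ≡⟨ followed a (s≤s (m≤m+n a b)) ⟩
  s a               ∎)
  where open ≡-Reasoning
... | suc zero , eq = c≢sb (begin
  c                 ≡⟨ sym si≡c ⟩
  s i               ≡⟨ eq ⟩
  s (i + suc b)     ≡⟨ followed b (s≤s (m≤n+m b a)) ⟩
  s b               ∎)
  where open ≡-Reasoning

-- The windows take 8 (drop k (φ^ n)) of all the φ^n(0); those near the end of φ^n(0)
-- are shorter than 8.
windowWords : List (List Letter)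
windowWords =
  [] ∷
  (l₀ ∷ []) ∷
  (l₁ ∷ []) ∷
  (l₂ ∷ []) ∷
  (l₀ ∷ l₁ ∷ []) ∷
  (l₀ ∷ l₂ ∷ []) ∷
  (l₁ ∷ l₀ ∷ []) ∷
  (l₀ ∷ l₁ ∷ l₀ ∷ []) ∷
  (l₁ ∷ l₀ ∷ l₂ ∷ []) ∷
  (l₂ ∷ l₀ ∷ l₁ ∷ []) ∷
  (l₀ ∷ l₁ ∷ l₀ ∷ l₂ ∷ []) ∷
  (l₀ ∷ l₂ ∷ l₀ ∷ l₁ ∷ []) ∷
  (l₂ ∷ l₀ ∷ l₁ ∷ l₀ ∷ []) ∷
  (l₀ ∷ l₀ ∷ l₁ ∷ l₀ ∷ l₂ ∷ []) ∷
  (l₀ ∷ l₂ ∷ l₀ ∷ l₁ ∷ l₀ ∷ []) ∷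
  (l₁ ∷ l₀ ∷ l₂ ∷ l₀ ∷ l₁ ∷ []) ∷
  (l₀ ∷ l₁ ∷ l₀ ∷ l₂ ∷ l₀ ∷ l₁ ∷ []) ∷
  (l₁ ∷ l₀ ∷ l₀ ∷ l₁ ∷ l₀ ∷ l₂ ∷ []) ∷
  (l₁ ∷ l₀ ∷ l₂ ∷ l₀ ∷ l₁ ∷ l₀ ∷ []) ∷
  (l₀ ∷ l₀ ∷ l₁ ∷ l₀ ∷ l₂ ∷ l₀ ∷ l₁ ∷ []) ∷
  (l₀ ∷ l₁ ∷ l₀ ∷ l₀ ∷ l₁ ∷ l₀ ∷ l₂ ∷ []) ∷
  (l₀ ∷ l₁ ∷ l₀ ∷ l₂ ∷ l₀ ∷ l₁ ∷ l₀ ∷ []) ∷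
  (l₀ ∷ l₀ ∷ l₁ ∷ l₀ ∷ l₂ ∷ l₀ ∷ l₁ ∷ l₀ ∷ []) ∷
  (l₀ ∷ l₁ ∷ l₀ ∷ l₀ ∷ l₁ ∷ l₀ ∷ l₂ ∷ l₀ ∷ []) ∷
  (l₀ ∷ l₁ ∷ l₀ ∷ l₁ ∷ l₀ ∷ l₂ ∷ l₀ ∷ l₁ ∷ []) ∷
  (l₀ ∷ l₁ ∷ l₀ ∷ l₂ ∷ l₀ ∷ l₁ ∷ l₀ ∷ l₀ ∷ []) ∷
  (l₀ ∷ l₁ ∷ l₀ ∷ l₂ ∷ l₀ ∷ l₁ ∷ l₀ ∷ l₁ ∷ []) ∷
  (l₀ ∷ l₁ ∷ l₀ ∷ l₂ ∷ l₀ ∷ l₁ ∷ l₀ ∷ l₂ ∷ []) ∷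
  (l₀ ∷ l₂ ∷ l₀ ∷ l₁ ∷ l₀ ∷ l₀ ∷ l₁ ∷ l₀ ∷ []) ∷
  (l₀ ∷ l₂ ∷ l₀ ∷ l₁ ∷ l₀ ∷ l₁ ∷ l₀ ∷ l₂ ∷ []) ∷
  (l₀ ∷ l₂ ∷ l₀ ∷ l₁ ∷ l₀ ∷ l₂ ∷ l₀ ∷ l₁ ∷ []) ∷
  (l₁ ∷ l₀ ∷ l₀ ∷ l₁ ∷ l₀ ∷ l₂ ∷ l₀ ∷ l₁ ∷ []) ∷
  (l₁ ∷ l₀ ∷ l₁ ∷ l₀ ∷ l₂ ∷ l₀ ∷ l₁ ∷ l₀ ∷ []) ∷
  (l₁ ∷ l₀ ∷ l₂ ∷ l₀ ∷ l₁ ∷ l₀ ∷ l₀ ∷ l₁ ∷ []) ∷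
  (l₁ ∷ l₀ ∷ l₂ ∷ l₀ ∷ l₁ ∷ l₀ ∷ l₁ ∷ l₀ ∷ []) ∷
  (l₁ ∷ l₀ ∷ l₂ ∷ l₀ ∷ l₁ ∷ l₀ ∷ l₂ ∷ l₀ ∷ []) ∷
  (l₂ ∷ l₀ ∷ l₁ ∷ l₀ ∷ l₀ ∷ l₁ ∷ l₀ ∷ l₂ ∷ []) ∷
  (l₂ ∷ l₀ ∷ l₁ ∷ l₀ ∷ l₁ ∷ l₀ ∷ l₂ ∷ l₀ ∷ []) ∷
  (l₂ ∷ l₀ ∷ l₁ ∷ l₀ ∷ l₂ ∷ l₀ ∷ l₁ ∷ l₀ ∷ []) ∷ []

Windows : List Letter → Set
Windows xs = ∀ k → take 8 (drop k xs) ∈ windowWords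

windowWords-φ*-closed : All (λ w → take 8 (φ* w) ∈ windowWords × take 8 (drop 1 (φ* w)) ∈ windowWords)
                            windowWords
windowWords-φ*-closed = toWitness {a? = All.all? (λ w → (take 8 (φ* w) ∈? windowWords)
                                                      ×-dec (take 8 (drop 1 (φ* w)) ∈? windowWords))
                                                 windowWords} tt

-- A window of φ*(xs) starts inside the image of some letter of xs, at offset 0 or 1.
Windows-φ* : ∀ xs → Windows xs → Windows (φ* xs)
Windows-φ* []        windows = windows
Windows-φ* (x ∷ xs)  windows zero =
  subst (_∈ windowWords) (sym (take-φ* 8 (x ∷ xs))) (proj₁ (All.lookup windowWords-φ*-closed (windows 0)))
Windows-φ* (l₀ ∷ xs) windows 1 =
  subst (λ w → l₁ ∷ w ∈ windowWords) (sym (take-φ* 7 xs)) (proj₂ (All.lookup windowWords-φ*-closed (windows 0)))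
Windows-φ* (l₁ ∷ xs) windows 1 =
  subst (λ w → l₂ ∷ w ∈ windowWords) (sym (take-φ* 7 xs)) (proj₂ (All.lookup windowWords-φ*-closed (windows 0)))
Windows-φ* (l₀ ∷ xs) windows (suc (suc k)) = Windows-φ* xs (λ k → windows (suc k)) k
Windows-φ* (l₁ ∷ xs) windows (suc (suc k)) = Windows-φ* xs (λ k → windows (suc k)) k
Windows-φ* (l₂ ∷ xs) windows (suc k)       = Windows-φ* xs (λ k → windows (suc k)) k

Windows-φ^ : ∀ n → Windows (φ^ n)
Windows-φ^ zero    zero          = there (here refl)
Windows-φ^ zero    (suc zero)    = here refl
Windows-φ^ zero    (suc (suc k)) = here refl
Windows-φ^ (suc n)               = Windows-φ* (φ^ n) (Windows-φ^ n)

window : ℕ → ℕ → List Letter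
window m i = take m (drop i (φ^ (i + m)))

length-window : ∀ m i → length (window m i) ≡ m
length-window m i = trans (length-take m _) (m≤n⇒m⊓n≡m m≤drop)
  where
  m≤drop : m ≤ length (drop i (φ^ (i + m)))
  m≤drop = subst (m ≤_) (sym (length-drop i (φ^ (i + m))))
                 (m+n≤o⇒m≤o∸n m (subst (_≤ length (φ^ (i + m))) (+-comm i m) (<⇒≤ (n<length-φ^ (i + m)))))

nth-window : ∀ m i {d} → d < m → nth (window m i) d ≡ tribonacci (i + d)
nth-window m i {d} d<m = begin
  nth (take m (drop i (φ^ (i + m)))) d    ≡⟨ nth-take m _ d<m ⟩
  nth (drop i (φ^ (i + m))) d             ≡⟨ nth-drop i _ d ⟩
  nth (φ^ (i + m)) (i + d)                ≡⟨ sym (tribonacci-φ^ (i + m) (<-trans (+-monoʳ-< i d<m) (n<length-φ^ (i + m)))) ⟩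
  tribonacci (i + d)                      ∎
  where open ≡-Reasoning

strictlyIncreasingPos? : ∀ {k} (p : Vec ℕ k) → Dec (StrictlyIncreasingPos p)
strictlyIncreasingPos? p =
  all? (λ j → 0 <? lookup p j) ×-dec
  all? (λ j → all? λ j′ → Data.Fin._<?_ j j′ →-dec lookup p j <? lookup p j′)

CoveredBy : ∀ {k} → Vec ℕ k → List Letter → Set
CoveredBy {k} p w = Σ (Fin k) λ j → nth w 0 ≡ nth w (lookup p j)

pseudoperiod : Vec ℕ 3
pseudoperiod = 4 ∷ 6 ∷ 7 ∷ []

windowWords-covered : All (λ w → length w ≡ 8 → CoveredBy pseudoperiod w) windowWords
windowWords-covered = toWitness {a? = All.all? (λ w → Data.Nat._≟_ (length w) 8 →-dec
                                                      any? λ j → Data.Fin._≟_ (nth w 0) (nth w (lookup pseudoperiod j)))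
                                               windowWords} tt

pseudoperiod<8 : ∀ j → lookup pseudoperiod j < 8
pseudoperiod<8 = toWitness {a? = all? λ j → lookup pseudoperiod j <? 8} tt

tribonacci-covered : ∀ i → Σ (Fin 3) λ j → tribonacci i ≡ tribonacci (i + lookup pseudoperiod j)
tribonacci-covered i =
  transfer (All.lookup windowWords-covered (Windows-φ^ (i + 8) i) (length-window 8 i))
  where
  open ≡-Reasoning
  transfer : CoveredBy pseudoperiod (window 8 i) →
             Σ (Fin 3) λ j → tribonacci i ≡ tribonacci (i + lookup pseudoperiod j)
  transfer (j , eq) = j , (begin
    tribonacci i                               ≡⟨ cong tribonacci (sym (+-identityʳ i)) ⟩
    tribonacci (i + 0)                         ≡⟨ sym (nth-window 8 i (s≤s z≤n)) ⟩
    nth (window 8 i) 0                         ≡⟨ eq ⟩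
    nth (window 8 i) (lookup pseudoperiod j)   ≡⟨ nth-window 8 i (pseudoperiod<8 j) ⟩
    tribonacci (i + lookup pseudoperiod j)     ∎)

theorem28 : Pseudoperiodic 3 tribonacci × ¬ Pseudoperiodic 2 tribonacci
theorem28 =
  (pseudoperiod , toWitness {a? = strictlyIncreasingPos? pseudoperiod} tt , tribonacci-covered) ,
  ¬2-pseudoperiodic tribonacci tribonacci-letter-before-prefix
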